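{- If $\mathbb{X}$ is a Cartesian closed differential category, then $\mathsf{LS}[\mathbb{X}]$ is a Cartesian closed differential category which is linearly closed.
   Context: A Cartesian left additive category is a category with chosen finite products (binary product $\times$, projections $\pi_0,\pi_1$, pairing $\langle-,-\rangle$, terminal object $\top$) in which each hom-set is a commutative monoid $(+,0)$, precomposition preserves the structure, and projections are additive. Write $f\times g=\langle f\circ\pi_0,g\circ\pi_1\rangle$. A Cartesian differential category is such a category with an operator $\mathsf{D}$ sending $f:A\to B$ to $\mathsf{D}[f]:A\times A\to B$ satisfying: [CD.1] $\mathsf{D}[f+g]=\mathsf{D}[f]+\mathsf{D}[g]$, $\mathsf{D}[0]=0$; [CD.2] $\mathsf{D}[f]\circ\langle a,b+c\rangle=\mathsf{D}[f]\circ\langle a,b\rangle+\mathsf{D}[f]\circ\langle a,c\rangle$, $\mathsf{D}[f]\circ\langle a,0\rangle=0$; [CD.3] $\mathsf{D}[1_A]=\pi_1$, $\mathsf{D}[\pi_j]=\pi_j\circ\pi_1$; [CD.4] $\mathsf{D}[\langle f,g\rangle]=\langle\mathsf{D}[f],\mathsf{D}[g]\rangle$; [CD.5] $\mathsf{D}[g\circ f]=\mathsf{D}[g]\circ\langle f\circ\pi_0,\mathsf{D}[f]\rangle$; [CD.6] $\mathsf{D}[\mathsf{D}[f]]\circ\langle\langle a,b\rangle,\langle 0,c\rangle\rangle=\mathsf{D}[f]\circ\langle a,c\rangle$; [CD.7] $\mathsf{D}[\mathsf{D}[f]]\circ\langle\langle a,b\rangle,\langle c,0\rangle\rangle=\mathsf{D}[\mathsf{D}[f]]\circ\langle\langle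 a,c\rangle,\langle b,0\rangle\rangle$. A map $f:A\to B$ is linear if $\mathsf{D}[f]\circ\langle a,b\rangle=f\circ b$ for all $a,b$. A map $f:A\times B\to C$ is linear in its second argument if $\mathsf{D}[f]\circ\langle\langle a,b\rangle,\langle 0,d\rangle\rangle=f\circ\langle a,d\rangle$, linear in its first argument if $\mathsf{D}[f]\circ\langle\langle a,b\rangle,\langle c,0\rangle\rangle=f\circ\langle c,b\rangle$, bilinear if both. A Cartesian differential category is linearly closed if for each $A,B$ there are an object $\mathcal{L}(A,B)$ and a bilinear $\varepsilon_\ell:\mathcal{L}(A,B)\times A\to B$ such that every $f:A\times B\to C$ linear in its second argument has a unique $\lambda_\ell(f):A\to\mathcal{L}(B,C)$ with $f=\varepsilon_\ell\circ(\lambda_\ell(f)\times 1_B)$. A Cartesian closed differential category is a Cartesian differential category which is Cartesian closed (internal hom $[A,B]$, evaluation $\epsilon:[A,B]\times A\to B$) with every $\epsilon$ linear in its first argument. For a Cartesian differential category $\mathbb{X}$, $\mathsf{LS}[\mathbb{X}]$ (its linear idempotent splitting) is the category whose objects are pairs $(A,e)$ with $e:A\to A$ a linear idempotent of $\mathbb{X}$ and whose maps $(A,e)\to(B,e')$ are maps $f:A\to B$ of $\mathbb{X}$ with $e'\circ f=f=f\circ e$, composition as in $\mathbb{X}$ and identity on $(A,e)$ given by $e$; products are $(A,e)\times(B,e')=(A\times B,e\times e')$ with terminal object $(\top,1_\top)$, sums and zeros of maps and the differential combinator are as in $\mathbb{X}$. -}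

module Defs where

open import Level using (Level; _⊔_) renaming (suc to lsuc)
open import Data.Product using (Σ; _,_; proj₁; proj₂) renaming (_×_ to _∧_)
open import Relation.Binary using (Rel; IsEquivalence; Setoid)
import Relation.Binary.Reasoning.Setoid as SetoidR

record RawCDC (o ℓ e : Level) : Set (lsuc (o ⊔ ℓ ⊔ e)) where
  infixr 9 _∘_
  infixl 6 _+_
  infix 4 _≈_
  infixr 7 _×_
  field
    Obj   : Set o
    _⇒_   : Obj → Obj → Set ℓ
    _≈_   : ∀ {A B} → Rel (A ⇒ B) e
    id    : ∀ {A} → A ⇒ A
    _∘_   : ∀ {A B C} → B ⇒ C → A ⇒ B → A ⇒ C
    ⊤     : Obj
    _×_   : Obj → Obj → Obj
    π₀    : ∀ {A B} → (A × B) ⇒ A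
    π₁    : ∀ {A B} → (A × B) ⇒ B
    ⟨_,_⟩ : ∀ {A B C} → C ⇒ A → C ⇒ B → C ⇒ (A × B)
    !     : ∀ {A} → A ⇒ ⊤
    _+_   : ∀ {A B} → A ⇒ B → A ⇒ B → A ⇒ B
    0m    : ∀ {A B} → A ⇒ B
    D     : ∀ {A B} → A ⇒ B → (A × A) ⇒ B

  infixr 8 _⁂_
  _⁂_ : ∀ {A B C E} → A ⇒ B → C ⇒ E → (A × C) ⇒ (B × E)
  f ⁂ g = ⟨ f ∘ π₀ , g ∘ π₁ ⟩

record IsCDC {o ℓ e} (R : RawCDC o ℓ e) : Set (o ⊔ ℓ ⊔ e) where
  open RawCDC R
  field
    isEquivalence : ∀ {A B} → IsEquivalence (_≈_ {A} {B})
    ∘-resp-≈  : ∀ {A B C} {f h : B ⇒ C} {g i : A ⇒ B} → f ≈ h → g ≈ i → f ∘ g ≈ h ∘ i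
    assoc     : ∀ {A B C E} {f : A ⇒ B} {g : B ⇒ C} {h : C ⇒ E} → (h ∘ g) ∘ f ≈ h ∘ (g ∘ f)
    identityˡ : ∀ {A B} {f : A ⇒ B} → id ∘ f ≈ f
    identityʳ : ∀ {A B} {f : A ⇒ B} → f ∘ id ≈ f
    ⟨⟩-resp-≈ : ∀ {A B C} {f h : C ⇒ A} {g i : C ⇒ B} → f ≈ h → g ≈ i → ⟨ f , g ⟩ ≈ ⟨ h , i ⟩
    project₀  : ∀ {A B C} {f : C ⇒ A} {g : C ⇒ B} → π₀ ∘ ⟨ f , g ⟩ ≈ f
    project₁  : ∀ {A B C} {f : C ⇒ A} {g : C ⇒ B} → π₁ ∘ ⟨ f , g ⟩ ≈ g
    ⟨⟩-unique : ∀ {A B C} {f : C ⇒ A} {g : C ⇒ B} {h : C ⇒ (A × B)} →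
                π₀ ∘ h ≈ f → π₁ ∘ h ≈ g → h ≈ ⟨ f , g ⟩
    !-unique  : ∀ {A} (f : A ⇒ ⊤) → f ≈ !
    +-resp-≈    : ∀ {A B} {f h g i : A ⇒ B} → f ≈ h → g ≈ i → f + g ≈ h + i
    +-assoc     : ∀ {A B} {f g h : A ⇒ B} → (f + g) + h ≈ f + (g + h)
    +-comm      : ∀ {A B} {f g : A ⇒ B} → f + g ≈ g + f
    +-identityˡ : ∀ {A B} {f : A ⇒ B} → 0m + f ≈ f
    +-∘ : ∀ {A B C} {f g : B ⇒ C} {h : A ⇒ B} → (f + g) ∘ h ≈ f ∘ h + g ∘ h
    0-∘ : ∀ {A B C} {h : A ⇒ B} → 0m {B} {C} ∘ h ≈ 0m
    π₀-+ : ∀ {A B C} {f g : C ⇒ (A × B)} → π₀ ∘ (f + g) ≈ π₀ ∘ f + π₀ ∘ g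
    π₀-0 : ∀ {A B C} → π₀ ∘ 0m {C} {A × B} ≈ 0m
    π₁-+ : ∀ {A B C} {f g : C ⇒ (A × B)} → π₁ ∘ (f + g) ≈ π₁ ∘ f + π₁ ∘ g
    π₁-0 : ∀ {A B C} → π₁ ∘ 0m {C} {A × B} ≈ 0m
    D-resp-≈ : ∀ {A B} {f g : A ⇒ B} → f ≈ g → D f ≈ D g
    CD1-+ : ∀ {A B} {f g : A ⇒ B} → D (f + g) ≈ D f + D g
    CD1-0 : ∀ {A B} → D (0m {A} {B}) ≈ 0m
    CD2-+ : ∀ {A B C} {f : A ⇒ B} {a b c : C ⇒ A} →
            D f ∘ ⟨ a , b + c ⟩ ≈ D f ∘ ⟨ a , b ⟩ + D f ∘ ⟨ a , c ⟩
    CD2-0 : ∀ {A B C} {f : A ⇒ B} {a : C ⇒ A} → D f ∘ ⟨ a , 0m ⟩ ≈ 0m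
    CD3-id : ∀ {A} → D (id {A}) ≈ π₁
    CD3-π₀ : ∀ {A B} → D (π₀ {A} {B}) ≈ π₀ ∘ π₁
    CD3-π₁ : ∀ {A B} → D (π₁ {A} {B}) ≈ π₁ ∘ π₁
    CD4 : ∀ {A B C} {f : A ⇒ B} {g : A ⇒ C} → D ⟨ f , g ⟩ ≈ ⟨ D f , D g ⟩
    CD5 : ∀ {A B C} {f : A ⇒ B} {g : B ⇒ C} → D (g ∘ f) ≈ D g ∘ ⟨ f ∘ π₀ , D f ⟩
    CD6 : ∀ {A B C} {f : A ⇒ B} {a b c : C ⇒ A} →
          D (D f) ∘ ⟨ ⟨ a , b ⟩ , ⟨ 0m , c ⟩ ⟩ ≈ D f ∘ ⟨ a , c ⟩
    CD7 : ∀ {A B C} {f : A ⇒ B} {a b c : C ⇒ A} →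
          D (D f) ∘ ⟨ ⟨ a , b ⟩ , ⟨ c , 0m ⟩ ⟩ ≈ D (D f) ∘ ⟨ ⟨ a , c ⟩ , ⟨ b , 0m ⟩ ⟩

record CDC (o ℓ e : Level) : Set (lsuc (o ⊔ ℓ ⊔ e)) where
  field
    raw   : RawCDC o ℓ e
    isCDC : IsCDC raw
  open RawCDC raw public
  open IsCDC isCDC public

module _ {o ℓ e} (R : RawCDC o ℓ e) where
  open RawCDC R

  IsLinear : ∀ {A B} → A ⇒ B → Set (o ⊔ ℓ ⊔ e)
  IsLinear {A} f = ∀ {C} (a b : C ⇒ A) → D f ∘ ⟨ a , b ⟩ ≈ f ∘ b

  LinearInSecond : ∀ {A B C} → (A × B) ⇒ C → Set (o ⊔ ℓ ⊔ e)
  LinearInSecond {A} {B} f = ∀ {X} (a : X ⇒ A) (b d : X ⇒ B) →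
    D f ∘ ⟨ ⟨ a , b ⟩ , ⟨ 0m , d ⟩ ⟩ ≈ f ∘ ⟨ a , d ⟩

  LinearInFirst : ∀ {A B C} → (A × B) ⇒ C → Set (o ⊔ ℓ ⊔ e)
  LinearInFirst {A} {B} f = ∀ {X} (a c : X ⇒ A) (b : X ⇒ B) →
    D f ∘ ⟨ ⟨ a , b ⟩ , ⟨ c , 0m ⟩ ⟩ ≈ f ∘ ⟨ c , b ⟩

  Bilinear : ∀ {A B C} → (A × B) ⇒ C → Set (o ⊔ ℓ ⊔ e)
  Bilinear f = LinearInFirst f ∧ LinearInSecond f

  record CartesianClosed : Set (o ⊔ ℓ ⊔ e) where
    field
      [_,_]   : Obj → Obj → Obj
      ev      : ∀ {A B} → ([ A , B ] × A) ⇒ B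
      curry   : ∀ {C A B} → (C × A) ⇒ B → C ⇒ [ A , B ]
      β       : ∀ {C A B} (f : (C × A) ⇒ B) → ev ∘ (curry f ⁂ id) ≈ f
      unique  : ∀ {C A B} (f : (C × A) ⇒ B) (g : C ⇒ [ A , B ]) →
                ev ∘ (g ⁂ id) ≈ f → g ≈ curry f

  record LinearlyClosed : Set (o ⊔ ℓ ⊔ e) where
    field
      𝓛          : Obj → Obj → Obj
      εℓ         : ∀ {A B} → (𝓛 A B × A) ⇒ B
      εℓ-bilinear : ∀ {A B} → Bilinear (εℓ {A} {B})
      λℓ         : ∀ {A B C} (f : (A × B) ⇒ C) → LinearInSecond f → A ⇒ 𝓛 B C
      λℓ-β       : ∀ {A B C} (f : (A × B) ⇒ C) (p : LinearInSecond f) →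
                   f ≈ εℓ ∘ (λℓ f p ⁂ id)
      λℓ-unique  : ∀ {A B C} (f : (A × B) ⇒ C) (p : LinearInSecond f)
                   (g : A ⇒ 𝓛 B C) → f ≈ εℓ ∘ (g ⁂ id) → g ≈ λℓ f p

  IsCCDC : Set (o ⊔ ℓ ⊔ e)
  IsCCDC = IsCDC R ∧ Σ CartesianClosed
             (λ cc → ∀ {A B} → LinearInFirst (CartesianClosed.ev cc {A} {B}))

module LSConstruction {o ℓ e} (X : CDC o ℓ e) where
  open CDC X

  hom-setoid : Obj → Obj → Setoid ℓ e
  hom-setoid A B = record { Carrier = A ⇒ B ; _≈_ = _≈_ ; isEquivalence = isEquivalence }

  module _ {A B : Obj} where
    open IsEquivalence (isEquivalence {A} {B}) public
      renaming (refl to ≈-refl; sym to ≈-sym; trans to ≈-trans)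

  ⟨⟩∘ : ∀ {A B C E} {f : C ⇒ A} {g : C ⇒ B} {h : E ⇒ C} →
        ⟨ f , g ⟩ ∘ h ≈ ⟨ f ∘ h , g ∘ h ⟩
  ⟨⟩∘ {f = f} {g} {h} = ⟨⟩-unique
    (≈-trans (≈-sym assoc) (∘-resp-≈ project₀ ≈-refl))
    (≈-trans (≈-sym assoc) (∘-resp-≈ project₁ ≈-refl))

  η : ∀ {A B} → ⟨ π₀ , π₁ ⟩ ≈ id {A × B}
  η = ≈-sym (⟨⟩-unique identityʳ identityʳ)

  ∘π₀⟨⟩ : ∀ {A B C E} {f : A ⇒ E} {a : C ⇒ A} {b : C ⇒ B} → (f ∘ π₀) ∘ ⟨ a , b ⟩ ≈ f ∘ a
  ∘π₀⟨⟩ = ≈-trans assoc (∘-resp-≈ ≈-refl project₀)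

  ∘π₁⟨⟩ : ∀ {A B C E} {f : B ⇒ E} {a : C ⇒ A} {b : C ⇒ B} → (f ∘ π₁) ∘ ⟨ a , b ⟩ ≈ f ∘ b
  ∘π₁⟨⟩ = ≈-trans assoc (∘-resp-≈ ≈-refl project₁)

  ⁂∘⟨⟩ : ∀ {A B C E Z} {f : A ⇒ B} {g : C ⇒ E} {h : Z ⇒ A} {k : Z ⇒ C} →
         (f ⁂ g) ∘ ⟨ h , k ⟩ ≈ ⟨ f ∘ h , g ∘ k ⟩
  ⁂∘⟨⟩ = ≈-trans ⟨⟩∘ (⟨⟩-resp-≈ ∘π₀⟨⟩ ∘π₁⟨⟩)

  lin-D : ∀ {A B} {f : A ⇒ B} → IsLinear raw f → D f ≈ f ∘ π₁
  lin-D {f = f} lin = ≈-trans (≈-sym identityʳ)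
    (≈-trans (∘-resp-≈ ≈-refl (≈-sym η)) (lin π₀ π₁))

  lin-+ : ∀ {A B C} {f : A ⇒ B} → IsLinear raw f → {g h : C ⇒ A} →
          f ∘ (g + h) ≈ f ∘ g + f ∘ h
  lin-+ lin {g} {h} = ≈-trans (≈-sym (lin g (g + h)))
    (≈-trans CD2-+ (+-resp-≈ (lin g g) (lin g h)))

  lin-0 : ∀ {A B C} {f : A ⇒ B} → IsLinear raw f → f ∘ 0m {C} ≈ 0m
  lin-0 lin = ≈-trans (≈-sym (lin 0m 0m)) CD2-0

  D∘π₀ : ∀ {A B C} {f : A ⇒ C} → D (f ∘ π₀ {A} {B}) ≈ D f ∘ ⟨ π₀ ∘ π₀ , π₀ ∘ π₁ ⟩
  D∘π₀ = ≈-trans CD5 (∘-resp-≈ ≈-refl (⟨⟩-resp-≈ ≈-refl CD3-π₀))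

  D∘π₁ : ∀ {A B C} {f : B ⇒ C} → D (f ∘ π₁ {A} {B}) ≈ D f ∘ ⟨ π₁ ∘ π₀ , π₁ ∘ π₁ ⟩
  D∘π₁ = ≈-trans CD5 (∘-resp-≈ ≈-refl (⟨⟩-resp-≈ ≈-refl CD3-π₁))

  record LSObj : Set (o ⊔ ℓ ⊔ e) where
    constructor mkObj
    field
      carrier    : Obj
      idem       : carrier ⇒ carrier
      idempotent : idem ∘ idem ≈ idem
      linear     : IsLinear raw idem
  open LSObj

  record LSHom (P Q : LSObj) : Set (ℓ ⊔ e) where
    constructor mkHom
    field
      map  : carrier P ⇒ carrier Q
      fixˡ : idem Q ∘ map ≈ map
      fixʳ : map ∘ idem P ≈ map
  open LSHom

  idemπ₀-lemma : ∀ {P : LSObj} {B} → idem P ∘ (idem P ∘ π₀ {carrier P} {B}) ≈ idem P ∘ π₀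
  idemπ₀-lemma {P} = ≈-trans (≈-sym assoc) (∘-resp-≈ (idempotent P) ≈-refl)

  idemπ₁-lemma : ∀ {P : LSObj} {A} → idem P ∘ (idem P ∘ π₁ {A} {carrier P}) ≈ idem P ∘ π₁
  idemπ₁-lemma {P} = ≈-trans (≈-sym assoc) (∘-resp-≈ (idempotent P) ≈-refl)

  prodObj : LSObj → LSObj → LSObj
  prodObj P Q = mkObj (carrier P × carrier Q) (idem P ⁂ idem Q) idm lin
    where
    idm : (idem P ⁂ idem Q) ∘ (idem P ⁂ idem Q) ≈ (idem P ⁂ idem Q)
    idm = ≈-trans ⁂∘⟨⟩ (⟨⟩-resp-≈ (idemπ₀-lemma {P}) (idemπ₁-lemma {Q}))
    lin : IsLinear raw (idem P ⁂ idem Q)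
    lin a b = ≈-trans (∘-resp-≈ CD4 ≈-refl) (≈-trans ⟨⟩∘ (≈-trans
      (⟨⟩-resp-≈
        (≈-trans (∘-resp-≈ D∘π₀ ≈-refl) (≈-trans assoc (≈-trans
          (∘-resp-≈ ≈-refl (≈-trans ⟨⟩∘ (⟨⟩-resp-≈ ∘π₀⟨⟩ ∘π₁⟨⟩)))
          (≈-trans (linear P _ _) (≈-sym assoc)))))
        (≈-trans (∘-resp-≈ D∘π₁ ≈-refl) (≈-trans assoc (≈-trans
          (∘-resp-≈ ≈-refl (≈-trans ⟨⟩∘ (⟨⟩-resp-≈ ∘π₀⟨⟩ ∘π₁⟨⟩)))
          (≈-trans (linear Q _ _) (≈-sym assoc))))))
      (≈-sym ⟨⟩∘)))

  terminalObj : LSObj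
  terminalObj = mkObj ⊤ id identityˡ
    (λ a b → ≈-trans (∘-resp-≈ CD3-id ≈-refl) (≈-trans project₁ (≈-sym identityˡ)))

  LS : RawCDC (o ⊔ ℓ ⊔ e) (ℓ ⊔ e) e
  LS = record
    { Obj   = LSObj
    ; _⇒_   = LSHom
    ; _≈_   = λ f g → map f ≈ map g
    ; id    = λ {P} → mkHom (idem P) (idempotent P) (idempotent P)
    ; _∘_   = λ {P} {Q} {S} g f → mkHom (map g ∘ map f)
                (≈-trans (≈-sym assoc) (∘-resp-≈ (fixˡ g) ≈-refl))
                (≈-trans assoc (∘-resp-≈ ≈-refl (fixʳ f)))
    ; ⊤     = terminalObj
    ; _×_   = prodObj
    ; π₀    = λ {P} {Q} → mkHom (idem P ∘ π₀) (idemπ₀-lemma {P})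
                (≈-trans ∘π₀⟨⟩ (idemπ₀-lemma {P}))
    ; π₁    = λ {P} {Q} → mkHom (idem Q ∘ π₁) (idemπ₁-lemma {Q})
                (≈-trans ∘π₁⟨⟩ (idemπ₁-lemma {Q}))
    ; ⟨_,_⟩ = λ f g → mkHom ⟨ map f , map g ⟩
                (≈-trans ⁂∘⟨⟩ (⟨⟩-resp-≈ (fixˡ f) (fixˡ g)))
                (≈-trans ⟨⟩∘ (⟨⟩-resp-≈ (fixʳ f) (fixʳ g)))
    ; !     = mkHom ! identityˡ (!-unique _)
    ; _+_   = λ {P} {Q} f g → mkHom (map f + map g)
                (≈-trans (lin-+ (linear Q)) (+-resp-≈ (fixˡ f) (fixˡ g)))
                (≈-trans +-∘ (+-resp-≈ (fixʳ f) (fixʳ g)))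
    ; 0m    = λ {P} {Q} → mkHom 0m (lin-0 (linear Q)) 0-∘
    ; D     = λ {P} {Q} f → mkHom (D (map f))
                (≈-sym (≈-trans (D-resp-≈ (≈-sym (fixˡ f)))
                  (≈-trans CD5 (≈-trans (linear Q _ _) ≈-refl))))
                (≈-sym (≈-trans (D-resp-≈ (≈-sym (fixʳ f)))
                  (≈-trans CD5 (∘-resp-≈ ≈-refl
                    (⟨⟩-resp-≈ ≈-refl (lin-D (linear P)))))))
    }

LS[_] : ∀ {o ℓ e} → CDC o ℓ e → RawCDC (o ⊔ ℓ ⊔ e) (ℓ ⊔ e) e
LS[ X ] = LSConstruction.LS X

-- Both internal homs of LS[X] from (A , e) to (B , e′) are obtained by splitting a linear
-- idempotent on [A , B].  For the Cartesian closed structure it is φ ↦ e′ ∘ φ ∘ e, the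
-- curry of e′ ∘ ev ∘ (1 × e).  For the linearly closed structure it is φ ↦ e′ ∘ D[φ](0 , -) ∘ e,
-- which replaces φ by its linearisation at 0; it is idempotent because a linear map is its
-- own linearisation [CD.6].  Both idempotents are linear because ev is linear in its first
-- argument, and the evaluation maps of LS[X] inherit that linearity, in the linearly closed
-- case through the symmetry of second derivatives [CD.7].
module Submission where

open import Data.Product using (_,_) renaming (_×_ to _∧_)
import Relation.Binary.Reasoning.Setoid as SetoidReasoning
open import Defs

module LinearIdempotentSplitting {o ℓ e} (X : CDC o ℓ e) where
  open CDC X
  open LSConstruction X
  open LSObj
  open LSHom

  module _ {A B : Obj} where
    open SetoidReasoning (hom-setoid A B) public

  infixr 4 _○_
  _○_ : ∀ {A B} {f g h : A ⇒ B} → f ≈ g → g ≈ h → f ≈ h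
  _○_ = ≈-trans

  ∘-resp-≈ʳ : ∀ {A B C} {f : B ⇒ C} {g i : A ⇒ B} → g ≈ i → f ∘ g ≈ f ∘ i
  ∘-resp-≈ʳ p = ∘-resp-≈ ≈-refl p

  ∘-resp-≈ˡ : ∀ {A B C} {f h : B ⇒ C} {g : A ⇒ B} → f ≈ h → f ∘ g ≈ h ∘ g
  ∘-resp-≈ˡ p = ∘-resp-≈ p ≈-refl

  ⟨⟩-resp-≈ʳ : ∀ {A B C} {f : C ⇒ A} {g i : C ⇒ B} → g ≈ i → ⟨ f , g ⟩ ≈ ⟨ f , i ⟩
  ⟨⟩-resp-≈ʳ p = ⟨⟩-resp-≈ ≈-refl p

  ⟨⟩-resp-≈ˡ : ∀ {A B C} {f h : C ⇒ A} {g : C ⇒ B} → f ≈ h → ⟨ f , g ⟩ ≈ ⟨ h , g ⟩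
  ⟨⟩-resp-≈ˡ p = ⟨⟩-resp-≈ p ≈-refl

  π₀∘⟨⟩∘ : ∀ {A B C E} {f : C ⇒ A} {g : C ⇒ B} {h : E ⇒ C} → π₀ ∘ (⟨ f , g ⟩ ∘ h) ≈ f ∘ h
  π₀∘⟨⟩∘ = ≈-sym assoc ○ ∘-resp-≈ˡ project₀

  π₁∘⟨⟩∘ : ∀ {A B C E} {f : C ⇒ A} {g : C ⇒ B} {h : E ⇒ C} → π₁ ∘ (⟨ f , g ⟩ ∘ h) ≈ g ∘ h
  π₁∘⟨⟩∘ = ≈-sym assoc ○ ∘-resp-≈ˡ project₁

  ∘⟨π₀,π₁⟩ : ∀ {A B C} {f : (A × B) ⇒ C} → f ∘ ⟨ π₀ , π₁ ⟩ ≈ f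
  ∘⟨π₀,π₁⟩ = ∘-resp-≈ʳ η ○ identityʳ

  0≈⟨0,0⟩ : ∀ {A B C} → 0m {C} {A × B} ≈ ⟨ 0m , 0m ⟩
  0≈⟨0,0⟩ = ⟨⟩-unique π₀-0 π₁-0

  idempotent-absorb : ∀ {A B} {g : A ⇒ B} {h : B ⇒ B} → h ∘ h ≈ h → h ∘ (h ∘ g) ≈ h ∘ g
  idempotent-absorb p = ≈-sym assoc ○ ∘-resp-≈ˡ p

  first : ∀ {A A′ B} → A ⇒ A′ → (A × B) ⇒ (A′ × B)
  first f = ⟨ f ∘ π₀ , π₁ ⟩

  second : ∀ {A B B′} → B ⇒ B′ → (A × B) ⇒ (A × B′)
  second f = ⟨ π₀ , f ∘ π₁ ⟩

  first∘⟨⟩ : ∀ {A A′ B Z} {f : A ⇒ A′} {x : Z ⇒ A} {y : Z ⇒ B} →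
             first f ∘ ⟨ x , y ⟩ ≈ ⟨ f ∘ x , y ⟩
  first∘⟨⟩ = ⟨⟩∘ ○ ⟨⟩-resp-≈ ∘π₀⟨⟩ project₁

  second∘⟨⟩ : ∀ {A B B′ Z} {f : B ⇒ B′} {x : Z ⇒ A} {y : Z ⇒ B} →
              second f ∘ ⟨ x , y ⟩ ≈ ⟨ x , f ∘ y ⟩
  second∘⟨⟩ = ⟨⟩∘ ○ ⟨⟩-resp-≈ project₀ ∘π₁⟨⟩

  π₀-linear : ∀ {A B} → IsLinear raw (π₀ {A} {B})
  π₀-linear a b = ∘-resp-≈ˡ CD3-π₀ ○ assoc ○ ∘-resp-≈ʳ project₁

  π₁-linear : ∀ {A B} → IsLinear raw (π₁ {A} {B})
  π₁-linear a b = ∘-resp-≈ˡ CD3-π₁ ○ assoc ○ ∘-resp-≈ʳ project₁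

  0-linear : ∀ {A B} → IsLinear raw (0m {A} {B})
  0-linear a b = ∘-resp-≈ˡ CD1-0 ○ 0-∘ ○ ≈-sym 0-∘

  chain-rule : ∀ {A B C Z} {f : A ⇒ B} {g : B ⇒ C} {p q : Z ⇒ A} →
               D (g ∘ f) ∘ ⟨ p , q ⟩ ≈ D g ∘ ⟨ f ∘ p , D f ∘ ⟨ p , q ⟩ ⟩
  chain-rule = ∘-resp-≈ˡ CD5 ○ assoc ○ ∘-resp-≈ʳ (⟨⟩∘ ○ ⟨⟩-resp-≈ˡ ∘π₀⟨⟩)

  D-∘-linearʳ : ∀ {A B C Z} {f : A ⇒ B} {g : B ⇒ C} {p q : Z ⇒ A} → IsLinear raw f →
                D (g ∘ f) ∘ ⟨ p , q ⟩ ≈ D g ∘ ⟨ f ∘ p , f ∘ q ⟩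
  D-∘-linearʳ f-lin = chain-rule ○ ∘-resp-≈ʳ (⟨⟩-resp-≈ʳ (f-lin _ _))

  D-∘-linearˡ : ∀ {A B C Z} {f : A ⇒ B} {g : B ⇒ C} {h : Z ⇒ (A × A)} → IsLinear raw g →
                D (g ∘ f) ∘ h ≈ g ∘ (D f ∘ h)
  D-∘-linearˡ g-lin = ∘-resp-≈ˡ (CD5 ○ ∘-resp-≈ˡ (lin-D g-lin) ○ ∘π₁⟨⟩) ○ assoc

  ∘-linear : ∀ {A B C} {f : A ⇒ B} {g : B ⇒ C} →
             IsLinear raw g → IsLinear raw f → IsLinear raw (g ∘ f)
  ∘-linear g-lin f-lin a b = D-∘-linearʳ f-lin ○ g-lin _ _ ○ ≈-sym assoc

  ⟨⟩-linear : ∀ {A B C} {f : A ⇒ B} {g : A ⇒ C} →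
              IsLinear raw f → IsLinear raw g → IsLinear raw ⟨ f , g ⟩
  ⟨⟩-linear f-lin g-lin a b =
    ∘-resp-≈ˡ CD4 ○ ⟨⟩∘ ○ ⟨⟩-resp-≈ (f-lin a b) (g-lin a b) ○ ≈-sym ⟨⟩∘

  second-linear : ∀ {A B B′} {f : B ⇒ B′} → IsLinear raw f → IsLinear raw (second {A} f)
  second-linear f-lin = ⟨⟩-linear π₀-linear (∘-linear f-lin π₁-linear)

  LS-π₀-+ : ∀ {P Q C} {f g : C ⇒ (carrier P × carrier Q)} →
            (idem P ∘ π₀) ∘ (f + g) ≈ (idem P ∘ π₀) ∘ f + (idem P ∘ π₀) ∘ g
  LS-π₀-+ {P} = assoc ○ ∘-resp-≈ʳ π₀-+ ○ lin-+ (linear P) ○ +-resp-≈ (≈-sym assoc) (≈-sym assoc)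

  LS-π₁-+ : ∀ {P Q C} {f g : C ⇒ (carrier P × carrier Q)} →
            (idem Q ∘ π₁) ∘ (f + g) ≈ (idem Q ∘ π₁) ∘ f + (idem Q ∘ π₁) ∘ g
  LS-π₁-+ {Q = Q} = assoc ○ ∘-resp-≈ʳ π₁-+ ○ lin-+ (linear Q) ○ +-resp-≈ (≈-sym assoc) (≈-sym assoc)

  LS-CD3-π₀ : ∀ {P Q} →
    D (idem P ∘ π₀ {carrier P} {carrier Q}) ≈ (idem P ∘ π₀) ∘ ((idem P ⁂ idem Q) ∘ π₁)
  LS-CD3-π₀ {P} {Q} = begin
    D (idem P ∘ π₀)                           ≈⟨ D∘π₀ ○ ∘-resp-≈ˡ (lin-D (linear P)) ○ ∘π₁⟨⟩ ⟩
    idem P ∘ (π₀ ∘ π₁)                        ≈⟨ idempotent-absorb (idempotent P) ⟨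
    idem P ∘ (idem P ∘ (π₀ ∘ π₁))             ≈⟨ ∘-resp-≈ʳ (π₀∘⟨⟩∘ ○ assoc) ⟨
    idem P ∘ (π₀ ∘ ((idem P ⁂ idem Q) ∘ π₁))  ≈⟨ assoc ⟨
    (idem P ∘ π₀) ∘ ((idem P ⁂ idem Q) ∘ π₁)  ∎

  LS-CD3-π₁ : ∀ {P Q} →
    D (idem Q ∘ π₁ {carrier P} {carrier Q}) ≈ (idem Q ∘ π₁) ∘ ((idem P ⁂ idem Q) ∘ π₁)
  LS-CD3-π₁ {P} {Q} = begin
    D (idem Q ∘ π₁)                           ≈⟨ D∘π₁ ○ ∘-resp-≈ˡ (lin-D (linear Q)) ○ ∘π₁⟨⟩ ⟩
    idem Q ∘ (π₁ ∘ π₁)                        ≈⟨ idempotent-absorb (idempotent Q) ⟨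
    idem Q ∘ (idem Q ∘ (π₁ ∘ π₁))             ≈⟨ ∘-resp-≈ʳ (π₁∘⟨⟩∘ ○ assoc) ⟨
    idem Q ∘ (π₁ ∘ ((idem P ⁂ idem Q) ∘ π₁))  ≈⟨ assoc ⟨
    (idem Q ∘ π₁) ∘ ((idem P ⁂ idem Q) ∘ π₁)  ∎

  isCDC-LS : IsCDC LS
  isCDC-LS = record
    { isEquivalence = record { refl = ≈-refl ; sym = ≈-sym ; trans = ≈-trans }
    ; ∘-resp-≈      = ∘-resp-≈
    ; assoc         = assoc
    ; identityˡ     = λ {_} {_} {f} → fixˡ f
    ; identityʳ     = λ {_} {_} {f} → fixʳ f
    ; ⟨⟩-resp-≈     = ⟨⟩-resp-≈
    ; project₀      = λ {_} {_} {_} {f} → ∘π₀⟨⟩ ○ fixˡ f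
    ; project₁      = λ {_} {_} {_} {_} {g} → ∘π₁⟨⟩ ○ fixˡ g
    ; ⟨⟩-unique     = λ {_} {_} {_} {_} {_} {h} p q → ≈-sym (fixˡ h) ○ ⟨⟩∘ ○ ⟨⟩-resp-≈ p q
    ; !-unique      = λ f → !-unique (map f)
    ; +-resp-≈      = +-resp-≈
    ; +-assoc       = +-assoc
    ; +-comm        = +-comm
    ; +-identityˡ   = +-identityˡ
    ; +-∘           = +-∘
    ; 0-∘           = 0-∘
    ; π₀-+          = λ {P} {Q} → LS-π₀-+ {P} {Q}
    ; π₀-0          = λ {P} → assoc ○ ∘-resp-≈ʳ π₀-0 ○ lin-0 (linear P)
    ; π₁-+          = λ {P} {Q} → LS-π₁-+ {P} {Q}
    ; π₁-0          = λ {_} {Q} → assoc ○ ∘-resp-≈ʳ π₁-0 ○ lin-0 (linear Q)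
    ; D-resp-≈      = D-resp-≈
    ; CD1-+         = CD1-+
    ; CD1-0         = CD1-0
    ; CD2-+         = CD2-+
    ; CD2-0         = CD2-0
    ; CD3-id        = λ {P} → lin-D (linear P)
    ; CD3-π₀        = λ {P} {Q} → LS-CD3-π₀ {P} {Q}
    ; CD3-π₁        = λ {P} {Q} → LS-CD3-π₁ {P} {Q}
    ; CD4           = CD4
    ; CD5           = λ {_} {_} {_} {f} → CD5 ○ ∘-resp-≈ʳ (⟨⟩-resp-≈ˡ (∘-resp-≈ˡ (≈-sym (fixʳ f)) ○ assoc))
    ; CD6           = CD6
    ; CD7           = CD7
    }

  module L = RawCDC LS

  module _ {S P Q : LSObj} (f : LSHom (prodObj S P) Q) where

    map∘⟨⟩-idem : ∀ {Z} {x : Z ⇒ carrier S} {y : Z ⇒ carrier P} →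
                  map f ∘ ⟨ x , y ⟩ ≈ map f ∘ ⟨ idem S ∘ x , idem P ∘ y ⟩
    map∘⟨⟩-idem = ∘-resp-≈ˡ (≈-sym (fixʳ f)) ○ assoc ○ ∘-resp-≈ʳ ⁂∘⟨⟩

    map∘first-idem : map f ∘ first (idem S) ≈ map f
    map∘first-idem =
      map∘⟨⟩-idem ○ ∘-resp-≈ʳ (⟨⟩-resp-≈ˡ (idempotent-absorb (idempotent S))) ○
      ≈-sym map∘⟨⟩-idem ○ ∘⟨π₀,π₁⟩

    map∘second-idem : map f ∘ second (idem P) ≈ map f
    map∘second-idem =
      map∘⟨⟩-idem ○ ∘-resp-≈ʳ (⟨⟩-resp-≈ʳ (idempotent-absorb (idempotent P))) ○
      ≈-sym map∘⟨⟩-idem ○ ∘⟨π₀,π₁⟩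

  module Closed (cc : CartesianClosed raw)
                (ev-linear : ∀ {A B} → LinearInFirst raw (CartesianClosed.ev cc {A} {B})) where
    open CartesianClosed cc

    ev-curry : ∀ {C A B Z} {f : (C × A) ⇒ B} {x : Z ⇒ C} {y : Z ⇒ A} →
               ev ∘ ⟨ curry f ∘ x , y ⟩ ≈ f ∘ ⟨ x , y ⟩
    ev-curry {f = f} =
      ∘-resp-≈ʳ (⟨⟩-resp-≈ʳ (≈-sym identityˡ) ○ ≈-sym ⁂∘⟨⟩) ○ ≈-sym assoc ○ ∘-resp-≈ˡ (β f)

    curry-unique : ∀ {C A B} {f : (C × A) ⇒ B} {g : C ⇒ [ A , B ]} →
                   ev ∘ first g ≈ f → g ≈ curry f
    curry-unique {f = f} {g} p = unique f g (∘-resp-≈ʳ (⟨⟩-resp-≈ʳ identityˡ) ○ p)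

    ev∘first-curry∘ : ∀ {C C′ A B} {f : (C × A) ⇒ B} {g : C′ ⇒ C} →
                      ev ∘ first (curry f ∘ g) ≈ f ∘ first g
    ev∘first-curry∘ = ∘-resp-≈ʳ (⟨⟩-resp-≈ˡ assoc) ○ ev-curry

    curry∘ : ∀ {C C′ A B} {f : (C × A) ⇒ B} {g : C′ ⇒ C} → curry f ∘ g ≈ curry (f ∘ first g)
    curry∘ = curry-unique ev∘first-curry∘

    curry-map∘idem : ∀ {S P Q} (f : LSHom (prodObj S P) Q) → curry (map f) ∘ idem S ≈ curry (map f)
    curry-map∘idem {S} {P} {Q} f = curry-unique (ev∘first-curry∘ ○ map∘first-idem {S} {P} {Q} f)

    D-via-ev : ∀ {C A B Z} {g : (C × A) ⇒ B} {x u : Z ⇒ C} {y v : Z ⇒ A} →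
      D g ∘ ⟨ ⟨ x , y ⟩ , ⟨ u , v ⟩ ⟩ ≈ D ev ∘ ⟨ ⟨ curry g ∘ x , y ⟩ , ⟨ D (curry g) ∘ ⟨ x , u ⟩ , v ⟩ ⟩
    D-via-ev {g = g} {x} {u} {y} {v} = begin
      D g ∘ ⟨ ⟨ x , y ⟩ , ⟨ u , v ⟩ ⟩
        ≈⟨ ∘-resp-≈ˡ (D-resp-≈ (ev-curry ○ ∘⟨π₀,π₁⟩)) ⟨
      D (ev ∘ first (curry g)) ∘ ⟨ ⟨ x , y ⟩ , ⟨ u , v ⟩ ⟩
        ≈⟨ chain-rule ⟩
      D ev ∘ ⟨ first (curry g) ∘ ⟨ x , y ⟩ , D (first (curry g)) ∘ ⟨ ⟨ x , y ⟩ , ⟨ u , v ⟩ ⟩ ⟩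
        ≈⟨ ∘-resp-≈ʳ (⟨⟩-resp-≈ first∘⟨⟩ D-first) ⟩
      D ev ∘ ⟨ ⟨ curry g ∘ x , y ⟩ , ⟨ D (curry g) ∘ ⟨ x , u ⟩ , v ⟩ ⟩ ∎
      where
      D-first : D (first (curry g)) ∘ ⟨ ⟨ x , y ⟩ , ⟨ u , v ⟩ ⟩ ≈ ⟨ D (curry g) ∘ ⟨ x , u ⟩ , v ⟩
      D-first = ∘-resp-≈ˡ CD4 ○ ⟨⟩∘ ○ ⟨⟩-resp-≈
        (D-∘-linearʳ π₀-linear ○ ∘-resp-≈ʳ (⟨⟩-resp-≈ project₀ project₀))
        (π₁-linear _ _ ○ project₁)

    curry-linear : ∀ {C A B} {g : (C × A) ⇒ B} → LinearInFirst raw g → IsLinear raw (curry g)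
    curry-linear {g = g} g-lin a b = curry-unique ev∘first-D-curry ○ ≈-sym curry∘
      where
      ev∘first-D-curry : ev ∘ first (D (curry g) ∘ ⟨ a , b ⟩) ≈ g ∘ first b
      ev∘first-D-curry = begin
        ev ∘ first (D (curry g) ∘ ⟨ a , b ⟩)
          ≈⟨ ∘-resp-≈ʳ (⟨⟩-resp-≈ˡ (assoc ○ ∘-resp-≈ʳ ⟨⟩∘)) ⟩
        ev ∘ ⟨ D (curry g) ∘ ⟨ a ∘ π₀ , b ∘ π₀ ⟩ , π₁ ⟩
          ≈⟨ ev-linear _ _ _ ⟨
        D ev ∘ ⟨ ⟨ curry g ∘ (a ∘ π₀) , π₁ ⟩ , ⟨ D (curry g) ∘ ⟨ a ∘ π₀ , b ∘ π₀ ⟩ , 0m ⟩ ⟩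
          ≈⟨ D-via-ev ⟨
        D g ∘ ⟨ ⟨ a ∘ π₀ , π₁ ⟩ , ⟨ b ∘ π₀ , 0m ⟩ ⟩
          ≈⟨ g-lin _ _ _ ⟩
        g ∘ first b ∎

    D-ev-at-curry : ∀ {C A B Z} {f : (C × A) ⇒ B} {x : Z ⇒ C} {y : Z ⇒ A} →
      D ev ∘ ⟨ ⟨ curry f ∘ x , 0m ⟩ , ⟨ 0m , y ⟩ ⟩ ≈ D f ∘ ⟨ ⟨ x , 0m ⟩ , ⟨ 0m , y ⟩ ⟩
    D-ev-at-curry = ≈-sym (D-via-ev ○ ∘-resp-≈ʳ (⟨⟩-resp-≈ʳ (⟨⟩-resp-≈ˡ CD2-0)))

    -- F restricts D[ev] to directions ⟨ ψ , 0 ⟩, where it is ev ∘ G by linearity of ev in its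
    -- first argument.
    D²ev-along-⟨ψ,0⟩ : ∀ {A B Z} {x w : Z ⇒ ([ A , B ] × A)} {ψ : Z ⇒ [ A , B ]} →
      D (D (ev {A} {B})) ∘ ⟨ ⟨ x , ⟨ ψ , 0m ⟩ ⟩ , ⟨ w , 0m ⟩ ⟩ ≈
      D ev ∘ ⟨ ⟨ ψ , π₁ ∘ x ⟩ , ⟨ 0m , π₁ ∘ w ⟩ ⟩
    D²ev-along-⟨ψ,0⟩ {A} {B} {x = x} {w} {ψ} = begin
      D (D ev) ∘ ⟨ ⟨ x , ⟨ ψ , 0m ⟩ ⟩ , ⟨ w , 0m ⟩ ⟩
        ≈⟨ ∘-resp-≈ʳ (⟨⟩-resp-≈ F∘⟨x,ψ,0⟩ F∘⟨w,0⟩) ⟨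
      D (D ev) ∘ ⟨ F ∘ ⟨ x , ⟨ ψ , 0m ⟩ ⟩ , F ∘ ⟨ w , 0m ⟩ ⟩
        ≈⟨ D-∘-linearʳ F-linear ⟨
      D (D ev ∘ F) ∘ ⟨ ⟨ x , ⟨ ψ , 0m ⟩ ⟩ , ⟨ w , 0m ⟩ ⟩
        ≈⟨ ∘-resp-≈ˡ (D-resp-≈ D-ev∘F) ⟩
      D (ev ∘ G) ∘ ⟨ ⟨ x , ⟨ ψ , 0m ⟩ ⟩ , ⟨ w , 0m ⟩ ⟩
        ≈⟨ D-∘-linearʳ G-linear ⟩
      D ev ∘ ⟨ G ∘ ⟨ x , ⟨ ψ , 0m ⟩ ⟩ , G ∘ ⟨ w , 0m ⟩ ⟩
        ≈⟨ ∘-resp-≈ʳ (⟨⟩-resp-≈ G∘⟨x,ψ,0⟩ G∘⟨w,0⟩) ⟩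
      D ev ∘ ⟨ ⟨ ψ , π₁ ∘ x ⟩ , ⟨ 0m , π₁ ∘ w ⟩ ⟩ ∎
      where
      E = [ A , B ] × A

      F : (E × E) ⇒ (E × E)
      F = ⟨ π₀ , ⟨ π₀ ∘ π₁ , 0m ⟩ ⟩

      G : (E × E) ⇒ E
      G = ⟨ π₀ ∘ π₁ , π₁ ∘ π₀ ⟩

      F-linear : IsLinear raw F
      F-linear = ⟨⟩-linear π₀-linear (⟨⟩-linear (∘-linear π₀-linear π₁-linear) 0-linear)

      G-linear : IsLinear raw G
      G-linear = ⟨⟩-linear (∘-linear π₀-linear π₁-linear) (∘-linear π₁-linear π₀-linear)

      D-ev∘F : D ev ∘ F ≈ ev ∘ G
      D-ev∘F = ∘-resp-≈ʳ (⟨⟩-resp-≈ˡ (⟨⟩-unique ≈-refl ≈-refl)) ○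
               ev-linear (π₀ ∘ π₀) (π₀ ∘ π₁) (π₁ ∘ π₀)

      F∘⟨x,ψ,0⟩ : F ∘ ⟨ x , ⟨ ψ , 0m ⟩ ⟩ ≈ ⟨ x , ⟨ ψ , 0m ⟩ ⟩
      F∘⟨x,ψ,0⟩ = ⟨⟩∘ ○ ⟨⟩-resp-≈ project₀ (⟨⟩∘ ○ ⟨⟩-resp-≈ (assoc ○ ∘-resp-≈ʳ project₁ ○ project₀) 0-∘)

      F∘⟨w,0⟩ : F ∘ ⟨ w , 0m ⟩ ≈ ⟨ w , 0m ⟩
      F∘⟨w,0⟩ = ⟨⟩∘ ○ ⟨⟩-resp-≈ project₀
        (⟨⟩∘ ○ ⟨⟩-resp-≈ (assoc ○ ∘-resp-≈ʳ project₁ ○ π₀-0) 0-∘ ○ ≈-sym 0≈⟨0,0⟩)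

      G∘⟨x,ψ,0⟩ : G ∘ ⟨ x , ⟨ ψ , 0m ⟩ ⟩ ≈ ⟨ ψ , π₁ ∘ x ⟩
      G∘⟨x,ψ,0⟩ = ⟨⟩∘ ○ ⟨⟩-resp-≈ (assoc ○ ∘-resp-≈ʳ project₁ ○ project₀) (assoc ○ ∘-resp-≈ʳ project₀)

      G∘⟨w,0⟩ : G ∘ ⟨ w , 0m ⟩ ≈ ⟨ 0m , π₁ ∘ w ⟩
      G∘⟨w,0⟩ = ⟨⟩∘ ○ ⟨⟩-resp-≈ (assoc ○ ∘-resp-≈ʳ project₁ ○ π₀-0) (assoc ○ ∘-resp-≈ʳ project₀)

    -- Any m that is a map of LS[X] and whose curry is idempotent splits off an object of
    -- LS[X] with evaluation m, universal among the maps f satisfying m ∘ first (curry f) ≈ f.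
    module SplitExponential (P Q : LSObj)
      (m : ([ carrier P , carrier Q ] × carrier P) ⇒ carrier Q)
      (m-fixˡ : idem Q ∘ m ≈ m)
      (m-fixʳ : m ∘ second (idem P) ≈ m)
      (m-idem : m ∘ first (curry m) ≈ m)
      (m-linearInFirst : LinearInFirst raw m) where

      split : [ carrier P , carrier Q ] ⇒ [ carrier P , carrier Q ]
      split = curry m

      split-idempotent : split ∘ split ≈ split
      split-idempotent = curry-unique (ev∘first-curry∘ ○ m-idem)

      m∘⟨⟩-idem : ∀ {Z} {x : Z ⇒ [ carrier P , carrier Q ]} {y : Z ⇒ carrier P} →
                  m ∘ ⟨ x , idem P ∘ y ⟩ ≈ m ∘ ⟨ x , y ⟩
      m∘⟨⟩-idem = ≈-sym (assoc ○ ∘-resp-≈ʳ second∘⟨⟩) ○ ∘-resp-≈ˡ m-fixʳ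

      obj : LSObj
      obj = mkObj [ carrier P , carrier Q ] split split-idempotent (curry-linear m-linearInFirst)

      eval : LSHom (prodObj obj P) Q
      eval = mkHom m m-fixˡ (m∘⟨⟩-idem ○ m-idem)

      eval-linearInFirst : LinearInFirst LS {obj} {P} {Q} eval
      eval-linearInFirst a c b = m-linearInFirst (map a) (map c) (map b)

      module _ {S : LSObj} where

        eval∘⁂id : (g : LSHom S obj) → map (eval L.∘ (g L.⁂ L.id {P})) ≈ m ∘ first (map g)
        eval∘⁂id g = ∘-resp-≈ʳ (⟨⟩-resp-≈ (≈-sym assoc ○ ∘-resp-≈ˡ (fixʳ g))
                                            (idempotent-absorb (idempotent P))) ○ m∘⟨⟩-idem

        lift : (f : LSHom (prodObj S P) Q) → m ∘ first (curry (map f)) ≈ map f → LSHom S obj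
        lift f h = mkHom (curry (map f))
          (curry-unique (ev∘first-curry∘ ○ h))
          (curry-map∘idem {S} {P} {Q} f)

        lift-β : (f : LSHom (prodObj S P) Q) (h : m ∘ first (curry (map f)) ≈ map f) →
                 eval L.∘ (lift f h L.⁂ L.id {P}) L.≈ f
        lift-β f h = eval∘⁂id (lift f h) ○ h

        lift-unique : (f : LSHom (prodObj S P) Q) (g : LSHom S obj) →
                      eval L.∘ (g L.⁂ L.id {P}) L.≈ f → map g ≈ curry (map f)
        lift-unique f g g-β = curry-unique
          (∘-resp-≈ʳ (⟨⟩-resp-≈ˡ (∘-resp-≈ˡ (≈-sym (fixˡ g)))) ○ ev∘first-curry∘ ○
           ≈-sym (eval∘⁂id g) ○ g-β)

    module Exponential (P Q : LSObj) where

      ev₀ : ([ carrier P , carrier Q ] × carrier P) ⇒ carrier Q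
      ev₀ = idem Q ∘ (ev ∘ second (idem P))

      ev₀-fixˡ : idem Q ∘ ev₀ ≈ ev₀
      ev₀-fixˡ = idempotent-absorb (idempotent Q)

      ev₀-fixʳ : ev₀ ∘ second (idem P) ≈ ev₀
      ev₀-fixʳ = assoc ○ ∘-resp-≈ʳ (assoc ○ ∘-resp-≈ʳ
        (second∘⟨⟩ ○ ⟨⟩-resp-≈ʳ (idempotent-absorb (idempotent P))))

      ev₀∘first-curry-fixed : ∀ {C} (f : (C × carrier P) ⇒ carrier Q) → idem Q ∘ f ≈ f →
                              f ∘ second (idem P) ≈ f → ev₀ ∘ first (curry f) ≈ f
      ev₀∘first-curry-fixed f f-fixˡ f-fixʳ =
        assoc ○ ∘-resp-≈ʳ (assoc ○ ∘-resp-≈ʳ second∘⟨⟩ ○ ev-curry ○ f-fixʳ) ○ f-fixˡ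

      ev₀-linearInFirst : LinearInFirst raw ev₀
      ev₀-linearInFirst a c b = begin
        D ev₀ ∘ ⟨ ⟨ a , b ⟩ , ⟨ c , 0m ⟩ ⟩
          ≈⟨ D-∘-linearˡ (linear Q) ⟩
        idem Q ∘ (D (ev ∘ second (idem P)) ∘ ⟨ ⟨ a , b ⟩ , ⟨ c , 0m ⟩ ⟩)
          ≈⟨ ∘-resp-≈ʳ (D-∘-linearʳ (second-linear (linear P))) ⟩
        idem Q ∘ (D ev ∘ ⟨ second (idem P) ∘ ⟨ a , b ⟩ , second (idem P) ∘ ⟨ c , 0m ⟩ ⟩)
          ≈⟨ ∘-resp-≈ʳ (∘-resp-≈ʳ (⟨⟩-resp-≈ second∘⟨⟩
                                     (second∘⟨⟩ ○ ⟨⟩-resp-≈ʳ (lin-0 (linear P))))) ⟩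
        idem Q ∘ (D ev ∘ ⟨ ⟨ a , idem P ∘ b ⟩ , ⟨ c , 0m ⟩ ⟩)
          ≈⟨ ∘-resp-≈ʳ (ev-linear a c (idem P ∘ b)) ⟩
        idem Q ∘ (ev ∘ ⟨ c , idem P ∘ b ⟩)
          ≈⟨ assoc ○ ∘-resp-≈ʳ (assoc ○ ∘-resp-≈ʳ second∘⟨⟩) ⟨
        ev₀ ∘ ⟨ c , b ⟩ ∎

      ev₀∘first-curry-map : ∀ {S} (f : LSHom (prodObj S P) Q) → ev₀ ∘ first (curry (map f)) ≈ map f
      ev₀∘first-curry-map {S} f = ev₀∘first-curry-fixed (map f) (fixˡ f) (map∘second-idem {S} {P} {Q} f)

      open SplitExponential P Q ev₀ ev₀-fixˡ ev₀-fixʳ (ev₀∘first-curry-fixed ev₀ ev₀-fixˡ ev₀-fixʳ)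
        ev₀-linearInFirst public

    module LinearHom (P Q : LSObj) where

      J : ([ carrier P , carrier Q ] × carrier P) ⇒
          (([ carrier P , carrier Q ] × carrier P) × ([ carrier P , carrier Q ] × carrier P))
      J = ⟨ ⟨ π₀ , 0m ⟩ , ⟨ 0m , idem P ∘ π₁ ⟩ ⟩

      J∘⟨⟩ : ∀ {Z} {x : Z ⇒ [ carrier P , carrier Q ]} {y : Z ⇒ carrier P} →
             J ∘ ⟨ x , y ⟩ ≈ ⟨ ⟨ x , 0m ⟩ , ⟨ 0m , idem P ∘ y ⟩ ⟩
      J∘⟨⟩ = ⟨⟩∘ ○ ⟨⟩-resp-≈ (⟨⟩∘ ○ ⟨⟩-resp-≈ project₀ 0-∘) (⟨⟩∘ ○ ⟨⟩-resp-≈ 0-∘ ∘π₁⟨⟩)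

      J-linear : IsLinear raw J
      J-linear = ⟨⟩-linear (⟨⟩-linear π₀-linear 0-linear)
                           (⟨⟩-linear 0-linear (∘-linear (linear P) π₁-linear))

      -- ev₀ (φ , a) is e′ applied to the derivative of φ at 0 in the direction e a.
      ev₀ : ([ carrier P , carrier Q ] × carrier P) ⇒ carrier Q
      ev₀ = idem Q ∘ (D ev ∘ J)

      ev₀∘⟨⟩ : ∀ {Z} {x : Z ⇒ [ carrier P , carrier Q ]} {y : Z ⇒ carrier P} →
               ev₀ ∘ ⟨ x , y ⟩ ≈ idem Q ∘ (D ev ∘ ⟨ ⟨ x , 0m ⟩ , ⟨ 0m , idem P ∘ y ⟩ ⟩)
      ev₀∘⟨⟩ = assoc ○ ∘-resp-≈ʳ (assoc ○ ∘-resp-≈ʳ J∘⟨⟩)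

      ev₀-fixˡ : idem Q ∘ ev₀ ≈ ev₀
      ev₀-fixˡ = idempotent-absorb (idempotent Q)

      ev₀-fixʳ : ev₀ ∘ second (idem P) ≈ ev₀
      ev₀-fixʳ = ev₀∘⟨⟩ ○ ∘-resp-≈ʳ (∘-resp-≈ʳ
        (⟨⟩-resp-≈ʳ (⟨⟩-resp-≈ʳ (idempotent-absorb (idempotent P)))))

      D-ev₀ : ∀ {Z} {u v : Z ⇒ ([ carrier P , carrier Q ] × carrier P)} →
              D ev₀ ∘ ⟨ u , v ⟩ ≈ idem Q ∘ (D (D ev) ∘ ⟨ J ∘ u , J ∘ v ⟩)
      D-ev₀ = D-∘-linearˡ (linear Q) ○ ∘-resp-≈ʳ (D-∘-linearʳ J-linear)

      ev₀-linearInSecond : LinearInSecond raw ev₀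
      ev₀-linearInSecond a b d = begin
        D ev₀ ∘ ⟨ ⟨ a , b ⟩ , ⟨ 0m , d ⟩ ⟩
          ≈⟨ D-ev₀ ○ ∘-resp-≈ʳ (∘-resp-≈ʳ (⟨⟩-resp-≈ J∘⟨⟩ (J∘⟨⟩ ○ ⟨⟩-resp-≈ˡ (≈-sym 0≈⟨0,0⟩)))) ⟩
        idem Q ∘ (D (D ev) ∘ ⟨ ⟨ ⟨ a , 0m ⟩ , ⟨ 0m , idem P ∘ b ⟩ ⟩ , ⟨ 0m , ⟨ 0m , idem P ∘ d ⟩ ⟩ ⟩)
          ≈⟨ ∘-resp-≈ʳ CD6 ⟩
        idem Q ∘ (D ev ∘ ⟨ ⟨ a , 0m ⟩ , ⟨ 0m , idem P ∘ d ⟩ ⟩)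
          ≈⟨ ev₀∘⟨⟩ ⟨
        ev₀ ∘ ⟨ a , d ⟩ ∎

      ev₀-linearInFirst : LinearInFirst raw ev₀
      ev₀-linearInFirst a c b = begin
        D ev₀ ∘ ⟨ ⟨ a , b ⟩ , ⟨ c , 0m ⟩ ⟩
          ≈⟨ D-ev₀ ○ ∘-resp-≈ʳ (∘-resp-≈ʳ (⟨⟩-resp-≈ J∘⟨⟩
               (J∘⟨⟩ ○ ⟨⟩-resp-≈ʳ (⟨⟩-resp-≈ʳ (lin-0 (linear P)) ○ ≈-sym 0≈⟨0,0⟩)))) ⟩
        idem Q ∘ (D (D ev) ∘ ⟨ ⟨ ⟨ a , 0m ⟩ , ⟨ 0m , idem P ∘ b ⟩ ⟩ , ⟨ ⟨ c , 0m ⟩ , 0m ⟩ ⟩)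
          ≈⟨ ∘-resp-≈ʳ CD7 ⟩
        idem Q ∘ (D (D ev) ∘ ⟨ ⟨ ⟨ a , 0m ⟩ , ⟨ c , 0m ⟩ ⟩ , ⟨ ⟨ 0m , idem P ∘ b ⟩ , 0m ⟩ ⟩)
          ≈⟨ ∘-resp-≈ʳ (D²ev-along-⟨ψ,0⟩ ○ ∘-resp-≈ʳ (⟨⟩-resp-≈ (⟨⟩-resp-≈ʳ project₁)
                                                                (⟨⟩-resp-≈ʳ project₁))) ⟩
        idem Q ∘ (D ev ∘ ⟨ ⟨ c , 0m ⟩ , ⟨ 0m , idem P ∘ b ⟩ ⟩)
          ≈⟨ ev₀∘⟨⟩ ⟨
        ev₀ ∘ ⟨ c , b ⟩ ∎

      ev₀∘⟨curry⟩ : ∀ {C Z} (f : (C × carrier P) ⇒ carrier Q) {x : Z ⇒ C} {y : Z ⇒ carrier P} →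
        ev₀ ∘ ⟨ curry f ∘ x , y ⟩ ≈ idem Q ∘ (D f ∘ ⟨ ⟨ x , 0m ⟩ , ⟨ 0m , idem P ∘ y ⟩ ⟩)
      ev₀∘⟨curry⟩ f = ev₀∘⟨⟩ ○ ∘-resp-≈ʳ D-ev-at-curry

      ev₀-idem : ev₀ ∘ first (curry ev₀) ≈ ev₀
      ev₀-idem = ev₀∘⟨curry⟩ ev₀ ○
        ∘-resp-≈ʳ (ev₀-linearInSecond π₀ 0m (idem P ∘ π₁) ○ ev₀-fixʳ) ○ ev₀-fixˡ

      ev₀∘first-curry-map : ∀ {S} (f : LSHom (prodObj S P) Q) → LinearInSecond LS {S} {P} {Q} f →
                            ev₀ ∘ first (curry (map f)) ≈ map f
      ev₀∘first-curry-map {S} f f-lin =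
        ∘-resp-≈ʳ (⟨⟩-resp-≈ˡ (∘-resp-≈ˡ (≈-sym (curry-map∘idem {S} {P} {Q} f)) ○ assoc)) ○
        ev₀∘⟨curry⟩ (map f) ○
        ∘-resp-≈ʳ (f-lin (L.π₀ {S} {P}) (L.0m {prodObj S P} {P}) (L.π₁ {S} {P}) ○ fixʳ f) ○ fixˡ f

      open SplitExponential P Q ev₀ ev₀-fixˡ ev₀-fixʳ ev₀-idem ev₀-linearInFirst public

      eval-linearInSecond : LinearInSecond LS {obj} {P} {Q} eval
      eval-linearInSecond a b d = ev₀-linearInSecond (map a) (map b) (map d)

    cartesianClosed-LS : CartesianClosed LS
    cartesianClosed-LS = record
      { [_,_]  = Exponential.obj
      ; ev     = λ {P} {Q} → Exponential.eval P Q
      ; curry  = λ {S} {P} {Q} f → lift P Q {S} f (ev₀∘first-curry-map P Q {S} f)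
      ; β      = λ {S} {P} {Q} f → lift-β P Q {S} f (ev₀∘first-curry-map P Q {S} f)
      ; unique = λ {S} {P} {Q} f g → lift-unique P Q {S} f g
      }
      where open Exponential

    linearlyClosed-LS : LinearlyClosed LS
    linearlyClosed-LS = record
      { 𝓛           = LinearHom.obj
      ; εℓ          = λ {P} {Q} → LinearHom.eval P Q
      ; εℓ-bilinear = λ {P} {Q} → eval-linearInFirst P Q , eval-linearInSecond P Q
      ; λℓ          = λ {S} {P} {Q} f p → lift P Q {S} f (ev₀∘first-curry-map P Q {S} f p)
      ; λℓ-β        = λ {S} {P} {Q} f p → ≈-sym (lift-β P Q {S} f (ev₀∘first-curry-map P Q {S} f p))
      ; λℓ-unique   = λ {S} {P} {Q} f p g f-β → lift-unique P Q {S} f g (≈-sym f-β)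
      }
      where open LinearHom

mainTheorem4 : ∀ {o ℓ e} (X : CDC o ℓ e)
    (cc : CartesianClosed (CDC.raw X)) →
    (∀ {A B} → LinearInFirst (CDC.raw X) (CartesianClosed.ev cc {A} {B})) →
    IsCCDC LS[ X ] ∧ LinearlyClosed LS[ X ]
mainTheorem4 X cc ev-linear =
  (isCDC-LS , cartesianClosed-LS , λ {P} {Q} → Exponential.eval-linearInFirst P Q) , linearlyClosed-LS
  where
  open LinearIdempotentSplitting X
  open Closed cc ev-linear
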